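{- Let $G$ be a graph with $\delta(G)\ge 2$. Then $\mathcal{R}(G\,\square\,K_2)$ is disconnected.
   Context: All graphs are finite, simple and undirected; $N(v)$ denotes the open neighbourhood of $v$ and $\delta$ the minimum degree. $G\,\square\,K_2$ is the Cartesian product (two copies of $G$ joined by the perfect matching between corresponding vertices). A set $S\subseteq V(G)$ is a dominating set if every vertex of $G$ is in $S$ or adjacent to a vertex of $S$; it is a minimal dominating set if no proper subset of $S$ is a dominating set. The reconfiguration graph $\mathcal{R}(G)$ has as vertex set the collection of all minimal dominating sets of $G$, and two minimal dominating sets $M_1,M_2$ are adjacent iff there is a vertex $v$ with either ($M_2\setminus M_1=\{v\}$ and $M_1\setminus M_2\subseteq N(v)$) or ($M_1\setminus M_2=\{v\}$ and $M_2\setminus M_1\subseteq N(v)$). -}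

module Defs where

open import Data.Nat using (ℕ; _+_; _≤_)
open import Data.Bool using (Bool; true; false)
open import Data.Fin using (Fin; splitAt)
open import Data.Fin.Properties using (_≟_)
open import Data.Fin.Subset using (Subset; _∈_; _⊆_; _⊂_; _─_; ⁅_⁆; ∣_∣)
open import Data.Vec using (tabulate)
open import Data.Sum using (_⊎_; inj₁; inj₂)
open import Data.Product using (Σ; _×_; ∃; ∃-syntax)
open import Relation.Nullary using (¬_; does; yes; no)
open import Data.Empty using (⊥-elim)
open import Relation.Binary.PropositionalEquality using (_≡_; refl)
import Relation.Binary.PropositionalEquality as Eq
open import Relation.Binary.Construct.Closure.ReflexiveTransitive using (Star)

record Graph (n : ℕ) : Set where
  field
    adj   : Fin n → Fin n → Bool
    sym   : ∀ u v → adj u v ≡ adj v u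
    irrefl : ∀ v → adj v v ≡ false

open Graph public

module _ {n : ℕ} (G : Graph n) where

  N : Fin n → Subset n
  N v = tabulate (adj G v)

  degree : Fin n → ℕ
  degree v = ∣ N v ∣

  MinDegree≥ : ℕ → Set
  MinDegree≥ k = ∀ v → k ≤ degree v

  IsDominating : Subset n → Set
  IsDominating S = ∀ v → v ∈ S ⊎ (∃[ u ] (u ∈ S × u ∈ N v))

  IsMinimalDominating : Subset n → Set
  IsMinimalDominating S = IsDominating S × (∀ T → T ⊂ S → ¬ IsDominating T)

  MDS : Set
  MDS = Σ (Subset n) IsMinimalDominating

  RAdj : MDS → MDS → Set
  RAdj (M₁ Data.Product., _) (M₂ Data.Product., _) =
    ∃[ v ] ( ((M₂ ─ M₁) ≡ ⁅ v ⁆ × (M₁ ─ M₂) ⊆ N v)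
           ⊎ ((M₁ ─ M₂) ≡ ⁅ v ⁆ × (M₂ ─ M₁) ⊆ N v))

  RConnected : Set
  RConnected = ∀ (M₁ M₂ : MDS) → Star RAdj M₁ M₂

  RDisconnected : Set
  RDisconnected = ¬ RConnected

-- Cartesian product G □ K₂ on Fin (n + n): the first copy is Fin n ↑ˡ n,
-- the second copy is n ↑ʳ Fin n; corresponding vertices are matched.
□K₂-adj : {n : ℕ} → Graph n → Fin (n + n) → Fin (n + n) → Bool
□K₂-adj {n} G x y with splitAt n x | splitAt n y
... | inj₁ a | inj₁ b = adj G a b
... | inj₂ a | inj₂ b = adj G a b
... | inj₁ a | inj₂ b = does (a ≟ b)
... | inj₂ a | inj₁ b = does (a ≟ b)

private
  ≟-sym : {n : ℕ} (a b : Fin n) → does (a ≟ b) ≡ does (b ≟ a)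
  ≟-sym a b with a ≟ b | b ≟ a
  ... | yes _ | yes _ = refl
  ... | no _  | no _  = refl
  ... | yes p | no q  = ⊥-elim (q (Eq.sym p))
  ... | no p  | yes q = ⊥-elim (p (Eq.sym q))

□K₂-sym : {n : ℕ} (G : Graph n) → ∀ x y → □K₂-adj G x y ≡ □K₂-adj G y x
□K₂-sym {n} G x y with splitAt n x | splitAt n y
... | inj₁ a | inj₁ b = sym G a b
... | inj₂ a | inj₂ b = sym G a b
... | inj₁ a | inj₂ b = ≟-sym a b
... | inj₂ a | inj₁ b = ≟-sym a b

□K₂-irrefl : {n : ℕ} (G : Graph n) → ∀ x → □K₂-adj G x x ≡ false
□K₂-irrefl {n} G x with splitAt n x
... | inj₁ a = irrefl G a
... | inj₂ a = irrefl G a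

_□K₂ : {n : ℕ} → Graph n → Graph (n + n)
G □K₂ = record { adj = □K₂-adj G ; sym = □K₂-sym G ; irrefl = □K₂-irrefl G }

-- The first copy V₁ of G is a minimal dominating set of G □ K₂, and it is an
-- isolated vertex of the reconfiguration graph. A minimal dominating set M
-- adjacent to V₁ differs from it by one vertex exchanged along an edge; either
-- way M contains the twin (a, 2) of some (a, 1) together with all (e, 1), e ≠ a.
-- Since δ(G) ≥ 2 there is a path a – b – c in G with b, c ≠ a, and then (b, 1) is
-- redundant in M: (c, 1) dominates it and (a, 2) dominates (b, 2). So M is not
-- minimal. As V₂ is another minimal dominating set, R(G □ K₂) is disconnected.
module Submission where

open import Defs
open import Data.Nat using (ℕ; suc; _+_; _≤_)
open import Data.Nat.Properties using (≤-trans; ≤-reflexive; ≤⇒≯)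
open import Data.Bool using (T)
open import Data.Bool.Properties using (T-≡)
open import Data.Fin using (Fin; zero; suc; _↑ˡ_; _↑ʳ_; splitAt)
open import Data.Fin.Properties using (_≟_; any?; splitAt-↑ˡ; splitAt-↑ʳ; splitAt⁻¹-↑ˡ; splitAt⁻¹-↑ʳ; ↑ˡ-injective)
open import Data.Fin.Subset using (Subset; outside; _∈_; _∉_; _⊆_; _⊂_; _─_; _-_; ⁅_⁆; ∣_∣; ⊤; ⊥)
open import Data.Fin.Subset.Properties using (_∈?_; ∈⊤; ∉⊥; x∈⁅x⁆; x∈⁅y⁆⇒x≡y; ∣⁅x⁆∣≡1; p⊆q⇒∣p∣≤∣q∣; p─q⊆p; x∈p∧x∉q⇒x∈p─q; x∈p∧x≢y⇒x∈p-y; x∈p⇒p-x⊂p)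
open import Data.Vec using ([]; _∷_; _++_; here; there)
open import Data.Vec.Properties using ([]=⇒lookup; lookup⇒[]=; lookup∘tabulate)
open import Data.Sum using (_⊎_; inj₁; inj₂)
open import Data.Product using (∃; _×_; _,_; proj₁)
open import Function using (_∘_; Equivalence)
open import Relation.Nullary using (¬_; _×-dec_; ¬?)
open import Relation.Nullary.Decidable using (does; dec-true; decidable-stable; yes; no)
open import Relation.Binary.PropositionalEquality using (_≡_; _≢_; refl; trans; cong; subst) renaming (sym to ≡-sym)
open import Relation.Binary.Construct.Closure.ReflexiveTransitive using (Star; ε; _◅_)
open import Data.Empty using (⊥-elim)

x∈p─q⇒x∉q : ∀ {k} {x : Fin k} (p q : Subset k) → x ∈ p ─ q → x ∉ q
x∈p─q⇒x∉q (_ ∷ _) (outside ∷ _) here ()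
x∈p─q⇒x∉q (_ ∷ p) (_ ∷ q) (there x∈p─q) (there x∈q) = x∈p─q⇒x∉q p q x∈p─q x∈q

x∈p─q≡⁅y⁆⇒x≡y : ∀ {k} {x y : Fin k} {p q : Subset k} → p ─ q ≡ ⁅ y ⁆ → x ∈ p ─ q → x ≡ y
x∈p─q≡⁅y⁆⇒x≡y {y = y} eq x∈ = x∈⁅y⁆⇒x≡y y (subst (_ ∈_) eq x∈)

y∈p─q≡⁅y⁆ : ∀ {k} {y : Fin k} {p q : Subset k} → p ─ q ≡ ⁅ y ⁆ → y ∈ p ─ q
y∈p─q≡⁅y⁆ {y = y} eq = subst (y ∈_) (≡-sym eq) (x∈⁅x⁆ y)

x∈p⇒x↑ˡ∈p++q : ∀ {k l} {x : Fin k} {p : Subset k} {q : Subset l} → x ∈ p → x ↑ˡ l ∈ p ++ q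
x∈p⇒x↑ˡ∈p++q here = here
x∈p⇒x↑ˡ∈p++q (there x∈p) = there (x∈p⇒x↑ˡ∈p++q x∈p)

x∈q⇒k↑ʳx∈p++q : ∀ {k l} {x : Fin l} (p : Subset k) {q : Subset l} → x ∈ q → k ↑ʳ x ∈ p ++ q
x∈q⇒k↑ʳx∈p++q [] x∈q = x∈q
x∈q⇒k↑ʳx∈p++q (_ ∷ p) x∈q = there (x∈q⇒k↑ʳx∈p++q p x∈q)

x↑ˡ∈p++q⇒x∈p : ∀ {k l} {x : Fin k} (p : Subset k) {q : Subset l} → x ↑ˡ l ∈ p ++ q → x ∈ p
x↑ˡ∈p++q⇒x∈p {x = zero} (_ ∷ _) here = here
x↑ˡ∈p++q⇒x∈p {x = suc x} (_ ∷ p) (there x∈) = there (x↑ˡ∈p++q⇒x∈p p x∈)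

k↑ʳx∈p++q⇒x∈q : ∀ {k l} {x : Fin l} (p : Subset k) {q : Subset l} → k ↑ʳ x ∈ p ++ q → x ∈ q
k↑ʳx∈p++q⇒x∈q [] x∈ = x∈
k↑ʳx∈p++q⇒x∈q (_ ∷ p) (there x∈) = k↑ʳx∈p++q⇒x∈q p x∈

∃∈∧≢ : ∀ {k} {p : Subset k} (a : Fin k) → 2 ≤ ∣ p ∣ → ∃ λ x → x ∈ p × x ≢ a
∃∈∧≢ {p = p} a 2≤∣p∣ with any? (λ x → x ∈? p ×-dec ¬? (x ≟ a))
... | yes found = found
... | no none = ⊥-elim (≤⇒≯ (≤-trans (p⊆q⇒∣p∣≤∣q∣ p⊆⁅a⁆) (≤-reflexive (∣⁅x⁆∣≡1 a))) 2≤∣p∣)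
  where
  p⊆⁅a⁆ : p ⊆ ⁅ a ⁆
  p⊆⁅a⁆ {x} x∈p = subst (λ y → x ∈ ⁅ y ⁆) x≡a (x∈⁅x⁆ x)
    where
    x≡a : x ≡ a
    x≡a = decidable-stable (x ≟ a) (λ x≢a → none (x , x∈p , x≢a))

Star-from-sink⇒≡ : ∀ {a r} {A : Set a} {R : A → A → Set r} {x y : A} →
                   (∀ z → ¬ R x z) → Star R x y → x ≡ y
Star-from-sink⇒≡ _ ε = refl
Star-from-sink⇒≡ sink (r ◅ _) = ⊥-elim (sink _ r)

module _ {k : ℕ} (K : Graph k) where

  ∈N⇒T-adj : ∀ {u v} → u ∈ N K v → T (adj K v u)
  ∈N⇒T-adj {u} {v} u∈ =
    Equivalence.from T-≡ (trans (≡-sym (lookup∘tabulate (adj K v) u)) ([]=⇒lookup u∈))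

  T-adj⇒∈N : ∀ {u v} → T (adj K v u) → u ∈ N K v
  T-adj⇒∈N {u} {v} t =
    lookup⇒[]= u (N K v) (trans (lookup∘tabulate (adj K v) u) (Equivalence.to T-≡ t))

  ∈N-sym : ∀ {u v} → u ∈ N K v → v ∈ N K u
  ∈N-sym {u} {v} u∈ = T-adj⇒∈N (subst T (sym K v u) (∈N⇒T-adj u∈))

  ∉N-self : ∀ {v} → v ∉ N K v
  ∉N-self {v} v∈ = subst T (irrefl K v) (∈N⇒T-adj v∈)

  private-neighbours⇒minimal : ∀ {S} → IsDominating K S →
    (∀ {x} → x ∈ S → ∃ λ y → y ∉ S × (∀ {u} → u ∈ S → u ∈ N K y → u ≡ x)) →
    IsMinimalDominating K S
  private-neighbours⇒minimal {S} dom private-nbr = dom , no-smaller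
    where
    no-smaller : ∀ T → T ⊂ S → ¬ IsDominating K T
    no-smaller T (T⊆S , x , x∈S , x∉T) T-dom with private-nbr x∈S
    ... | y , y∉S , only-x with T-dom y
    ...   | inj₁ y∈T = y∉S (T⊆S y∈T)
    ...   | inj₂ (u , u∈T , u∈N) = x∉T (subst (_∈ T) (only-x (T⊆S u∈T) u∈N) u∈T)

  redundant⇒¬minimal : ∀ {S w} → w ∈ S → IsDominating K (S - w) → ¬ IsMinimalDominating K S
  redundant⇒¬minimal w∈S dom (_ , minimal) = minimal _ (x∈p⇒p-x⊂p w∈S) dom

  dominating-without : ∀ {S w} →
    (∀ v → (v ∈ S × v ≢ w) ⊎ (∃ λ u → u ∈ S × u ≢ w × u ∈ N K v)) → IsDominating K (S - w)
  dominating-without covered v with covered v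
  ... | inj₁ (v∈S , v≢w) = inj₁ (x∈p∧x≢y⇒x∈p-y v∈S v≢w)
  ... | inj₂ (u , u∈S , u≢w , u∈N) = inj₂ (u , x∈p∧x≢y⇒x∈p-y u∈S u≢w , u∈N)

module Prism {n : ℕ} (G : Graph n) where

  H : Graph (n + n)
  H = G □K₂

  ι₁ ι₂ : Fin n → Fin (n + n)
  ι₁ a = a ↑ˡ n
  ι₂ a = n ↑ʳ a

  data Copy : Fin (n + n) → Set where
    first  : ∀ a → Copy (ι₁ a)
    second : ∀ a → Copy (ι₂ a)

  copy : ∀ x → Copy x
  copy x with splitAt n x in eq
  ... | inj₁ a = subst Copy (splitAt⁻¹-↑ˡ eq) (first a)
  ... | inj₂ a = subst Copy (splitAt⁻¹-↑ʳ eq) (second a)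

  ι₂≢ι₁ : ∀ {a b} → ι₂ a ≢ ι₁ b
  ι₂≢ι₁ {a} {b} eq
    with trans (≡-sym (splitAt-↑ʳ n n a)) (trans (cong (splitAt n) eq) (splitAt-↑ˡ n b n))
  ... | ()

  ι₁-≢ : ∀ {a b} → a ≢ b → ι₁ a ≢ ι₁ b
  ι₁-≢ {a} {b} a≢b = a≢b ∘ ↑ˡ-injective n a b

  adj-ι₁-ι₁ : ∀ a b → adj H (ι₁ a) (ι₁ b) ≡ adj G a b
  adj-ι₁-ι₁ a b rewrite splitAt-↑ˡ n a n | splitAt-↑ˡ n b n = refl

  adj-ι₂-ι₂ : ∀ a b → adj H (ι₂ a) (ι₂ b) ≡ adj G a b
  adj-ι₂-ι₂ a b rewrite splitAt-↑ʳ n n a | splitAt-↑ʳ n n b = refl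

  adj-ι₁-ι₂ : ∀ a b → adj H (ι₁ a) (ι₂ b) ≡ does (a ≟ b)
  adj-ι₁-ι₂ a b rewrite splitAt-↑ˡ n a n | splitAt-↑ʳ n n b = refl

  adj-ι₂-ι₁ : ∀ a b → adj H (ι₂ a) (ι₁ b) ≡ does (a ≟ b)
  adj-ι₂-ι₁ a b rewrite splitAt-↑ʳ n n a | splitAt-↑ˡ n b n = refl

  ι₁∈N[ι₁] : ∀ {a b} → b ∈ N G a → ι₁ b ∈ N H (ι₁ a)
  ι₁∈N[ι₁] {a} {b} b∈ = T-adj⇒∈N H (subst T (≡-sym (adj-ι₁-ι₁ a b)) (∈N⇒T-adj G b∈))

  ι₂∈N[ι₂] : ∀ {a b} → b ∈ N G a → ι₂ b ∈ N H (ι₂ a)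
  ι₂∈N[ι₂] {a} {b} b∈ = T-adj⇒∈N H (subst T (≡-sym (adj-ι₂-ι₂ a b)) (∈N⇒T-adj G b∈))

  ι₂∈N[ι₁] : ∀ a → ι₂ a ∈ N H (ι₁ a)
  ι₂∈N[ι₁] a = 
    T-adj⇒∈N H (subst T (≡-sym (adj-ι₁-ι₂ a a)) (Equivalence.from T-≡ (dec-true (a ≟ a) refl)))

  ι₁∈N[ι₂] : ∀ a → ι₁ a ∈ N H (ι₂ a)
  ι₁∈N[ι₂] a = 
    T-adj⇒∈N H (subst T (≡-sym (adj-ι₂-ι₁ a a)) (Equivalence.from T-≡ (dec-true (a ≟ a) refl)))

  ι₂∈N[ι₁]⇒≡ : ∀ {a e} → ι₂ e ∈ N H (ι₁ a) → a ≡ e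
  ι₂∈N[ι₁]⇒≡ {a} {e} e∈ with a ≟ e | subst T (adj-ι₁-ι₂ a e) (∈N⇒T-adj H e∈)
  ... | yes a≡e | _ = a≡e
  ... | no _    | ()

  ι₁∈N[ι₂]⇒≡ : ∀ {a e} → ι₁ e ∈ N H (ι₂ a) → a ≡ e
  ι₁∈N[ι₂]⇒≡ {a} {e} e∈ with a ≟ e | subst T (adj-ι₂-ι₁ a e) (∈N⇒T-adj H e∈)
  ... | yes a≡e | _ = a≡e
  ... | no _    | ()

  copy₁ copy₂ : Subset (n + n)
  copy₁ = ⊤ {n} ++ ⊥ {n}
  copy₂ = ⊥ {n} ++ ⊤ {n}

  ι₁∈copy₁ : ∀ {a} → ι₁ a ∈ copy₁
  ι₁∈copy₁ = x∈p⇒x↑ˡ∈p++q ∈⊤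

  ι₂∉copy₁ : ∀ {a} → ι₂ a ∉ copy₁
  ι₂∉copy₁ = ∉⊥ ∘ k↑ʳx∈p++q⇒x∈q (⊤ {n})

  ι₂∈copy₂ : ∀ {a} → ι₂ a ∈ copy₂
  ι₂∈copy₂ = x∈q⇒k↑ʳx∈p++q (⊥ {n}) ∈⊤

  ι₁∉copy₂ : ∀ {a} → ι₁ a ∉ copy₂
  ι₁∉copy₂ = ∉⊥ ∘ x↑ˡ∈p++q⇒x∈p (⊥ {n})

  copy₁-minimal : IsMinimalDominating H copy₁
  copy₁-minimal = private-neighbours⇒minimal H dominating twin-private
    where
    dominating : IsDominating H copy₁
    dominating v with copy v
    ... | first a  = inj₁ ι₁∈copy₁
    ... | second a = inj₂ (ι₁ a , ι₁∈copy₁ , ι₁∈N[ι₂] a)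
    twin-private : ∀ {x} → x ∈ copy₁ →
                   ∃ λ y → y ∉ copy₁ × (∀ {u} → u ∈ copy₁ → u ∈ N H y → u ≡ x)
    twin-private {x} x∈ with copy x
    ... | second a = ⊥-elim (ι₂∉copy₁ x∈)
    ... | first a  = ι₂ a , ι₂∉copy₁ , only-twin
      where
      only-twin : ∀ {u} → u ∈ copy₁ → u ∈ N H (ι₂ a) → u ≡ ι₁ a
      only-twin {u} u∈ u∈N with copy u
      ... | first e  = cong ι₁ (≡-sym (ι₁∈N[ι₂]⇒≡ u∈N))
      ... | second e = ⊥-elim (ι₂∉copy₁ u∈)

  copy₂-minimal : IsMinimalDominating H copy₂
  copy₂-minimal = private-neighbours⇒minimal H dominating twin-private
    where
    dominating : IsDominating H copy₂
    dominating v with copy v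
    ... | second a = inj₁ ι₂∈copy₂
    ... | first a  = inj₂ (ι₂ a , ι₂∈copy₂ , ι₂∈N[ι₁] a)
    twin-private : ∀ {x} → x ∈ copy₂ →
                   ∃ λ y → y ∉ copy₂ × (∀ {u} → u ∈ copy₂ → u ∈ N H y → u ≡ x)
    twin-private {x} x∈ with copy x
    ... | first a  = ⊥-elim (ι₁∉copy₂ x∈)
    ... | second a = ι₁ a , ι₁∉copy₂ , only-twin
      where
      only-twin : ∀ {u} → u ∈ copy₂ → u ∈ N H (ι₁ a) → u ≡ ι₂ a
      only-twin {u} u∈ u∈N with copy u
      ... | second e = cong ι₂ (≡-sym (ι₂∈N[ι₁]⇒≡ u∈N))
      ... | first e  = ⊥-elim (ι₁∉copy₂ u∈)

  copy₁-MDS copy₂-MDS : MDS H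
  copy₁-MDS = copy₁ , copy₁-minimal
  copy₂-MDS = copy₂ , copy₂-minimal

  swapped-twin⇒¬minimal : MinDegree≥ G 2 → ∀ {M} a → ι₂ a ∈ M → (∀ {e} → e ≢ a → ι₁ e ∈ M) →
                           ¬ IsMinimalDominating H M
  swapped-twin⇒¬minimal δ≥2 {M} a ι₂a∈M ι₁∈M with ∃∈∧≢ a (δ≥2 a)
  ... | b , b∈N[a] , b≢a with ∃∈∧≢ a (δ≥2 b)
  ... | c , c∈N[b] , c≢a = redundant⇒¬minimal H (ι₁∈M b≢a) (dominating-without H covered)
    where
    c≢b : c ≢ b
    c≢b refl = ∉N-self G c∈N[b]
    covered : ∀ v → (v ∈ M × v ≢ ι₁ b) ⊎ (∃ λ u → u ∈ M × u ≢ ι₁ b × u ∈ N H v)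
    covered v with copy v
    covered v | first e with e ≟ a
    ... | yes refl = inj₂ (ι₂ a , ι₂a∈M , ι₂≢ι₁ , ι₂∈N[ι₁] a)
    ... | no e≢a with e ≟ b
    ...   | yes refl = inj₂ (ι₁ c , ι₁∈M c≢a , ι₁-≢ c≢b , ι₁∈N[ι₁] c∈N[b])
    ...   | no e≢b   = inj₁ (ι₁∈M e≢a , ι₁-≢ e≢b)
    covered v | second e with e ≟ a
    ... | yes refl = inj₁ (ι₂a∈M , ι₂≢ι₁)
    ... | no e≢a with e ≟ b
    ...   | yes refl = inj₂ (ι₂ a , ι₂a∈M , ι₂≢ι₁ , ι₂∈N[ι₂] (∈N-sym G b∈N[a]))
    ...   | no e≢b   = inj₂ (ι₁ e , ι₁∈M e≢a , ι₁-≢ e≢b , ι₁∈N[ι₂] e)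

  module _ (δ≥2 : MinDegree≥ G 2) {M : Subset (n + n)} (M-minimal : IsMinimalDominating H M) where

    ¬copy₁+vertex : ∀ {v} → M ─ copy₁ ≡ ⁅ v ⁆ → ¬ (copy₁ ─ M ⊆ N H v)
    ¬copy₁+vertex {v} added removed⊆N[v] with copy v | y∈p─q≡⁅y⁆ added
    ... | first a  | v∈M─copy₁ = x∈p─q⇒x∉q M copy₁ v∈M─copy₁ ι₁∈copy₁
    ... | second a | v∈M─copy₁ =
      swapped-twin⇒¬minimal δ≥2 a (p─q⊆p M copy₁ v∈M─copy₁) ι₁∈M M-minimal
      where
      ι₁∈M : ∀ {e} → e ≢ a → ι₁ e ∈ M
      ι₁∈M {e} e≢a = decidable-stable (ι₁ e ∈? M) λ ι₁e∉M →
        e≢a (≡-sym (ι₁∈N[ι₂]⇒≡ (removed⊆N[v] (x∈p∧x∉q⇒x∈p─q ι₁∈copy₁ ι₁e∉M))))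

    ¬copy₁-vertex : ∀ {v} → copy₁ ─ M ≡ ⁅ v ⁆ → ¬ (M ─ copy₁ ⊆ N H v)
    ¬copy₁-vertex {v} removed added⊆N[v] with copy v | y∈p─q≡⁅y⁆ removed
    ... | second a | v∈copy₁─M = ι₂∉copy₁ (p─q⊆p copy₁ M v∈copy₁─M)
    ... | first a  | v∈copy₁─M = swapped-twin⇒¬minimal δ≥2 a ι₂a∈M ι₁∈M M-minimal
      where
      ι₁∈M : ∀ {e} → e ≢ a → ι₁ e ∈ M
      ι₁∈M {e} e≢a = decidable-stable (ι₁ e ∈? M) λ ι₁e∉M →
        e≢a (↑ˡ-injective n e a (x∈p─q≡⁅y⁆⇒x≡y removed (x∈p∧x∉q⇒x∈p─q ι₁∈copy₁ ι₁e∉M)))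
      -- ι₁ a has left M, and a dominator of ι₂ a in the second copy was added, hence is adjacent to ι₁ a.
      ι₂a∈M : ι₂ a ∈ M
      ι₂a∈M with proj₁ M-minimal (ι₂ a)
      ... | inj₁ ι₂a∈M = ι₂a∈M
      ... | inj₂ (u , u∈M , u∈N) with copy u
      ...   | first e with ι₁∈N[ι₂]⇒≡ u∈N
      ...     | refl = ⊥-elim (x∈p─q⇒x∉q copy₁ M v∈copy₁─M u∈M)
      ι₂a∈M | inj₂ (u , u∈M , u∈N) | second e
        with ι₂∈N[ι₁]⇒≡ (added⊆N[v] (x∈p∧x∉q⇒x∈p─q u∈M ι₂∉copy₁))
      ... | refl = u∈M

  copy₁-isolated : MinDegree≥ G 2 → ∀ X → ¬ RAdj H copy₁-MDS X
  copy₁-isolated δ≥2 (M , M-minimal) (v , inj₁ (added , removed⊆N[v])) =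
    ¬copy₁+vertex δ≥2 M-minimal added removed⊆N[v]
  copy₁-isolated δ≥2 (M , M-minimal) (v , inj₂ (removed , added⊆N[v])) =
    ¬copy₁-vertex δ≥2 M-minimal removed added⊆N[v]

corollary2 : (n : ℕ) → 1 ≤ n → (G : Graph n) → MinDegree≥ G 2 → RDisconnected (G □K₂)
corollary2 (suc n) _ G δ≥2 connected = ι₁∉copy₂ (subst (ι₁ zero ∈_) copy₁≡copy₂ ι₁∈copy₁)
  where
  open Prism G
  copy₁≡copy₂ : copy₁ ≡ copy₂
  copy₁≡copy₂ = cong proj₁ (Star-from-sink⇒≡ (copy₁-isolated δ≥2) (connected copy₁-MDS copy₂-MDS))
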